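{- Let $f$ be a $1$-modular set function over $U=[n]$ ($n\ge2$) whose closest linear set function is the zero function, and let $M=\max_S|f(S)|$. Let $\mathrm{PS}^*$ be a collection (multiset) of $2k$ subsets of $U$ in which every item lies in exactly $k$ sets, let $\mathrm{NS}^*$ be the collection of complements of the sets of $\mathrm{PS}^*$, and suppose the average deficit $d$ of $\mathrm{PS}^*$ and the average surplus $s$ of $\mathrm{NS}^*$ satisfy $d+s\le1$. For $\ell\ge1$ let $d_\ell$ be the average deficit of $P_1\cap\dots\cap P_\ell$ over all $\ell$-tuples $(P_1,\dots,P_\ell)$ of sets of $\mathrm{PS}^*$, and $s_\ell$ the average surplus of $N_1\cap\dots\cap N_\ell$ over all $\ell$-tuples of sets of $\mathrm{NS}^*$. Then for even $\ell$, $d_\ell+s_\ell\le\frac{5\ell}{2}-2$, and for odd $\ell$, $d_\ell+s_\ell\le\frac{5(\ell-1)}{2}+1$.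
   Context: $1$-modular: $|f(S)+f(T)-f(S\cup T)-f(S\cap T)|\le1$ for all $S,T\subseteq U$. Linear set functions are $\ell(S)=c_0+\sum_{i\in S}c_i$; "closest linear set function is the zero function" means the zero function minimizes $\max_S|f(S)-\ell(S)|$ over linear $\ell$. Deficit of a set $S$ is $M-f(S)$; surplus is $f(S)+M$. Averages are taken uniformly, counting multiplicities (tuples are ordered and may repeat sets).
   Formalization: The set function f takes rational values instead of real ones, and the linear set functions in the closest-linear hypothesis are taken with rational coefficients. -}

module Defs where

open import Data.Bool using (Bool; true; false)
open import Data.Nat as ℕ using (ℕ; zero; suc)
open import Data.Integer using (+_)
open import Data.Rational using (ℚ; 0ℚ; _+_; _-_; _*_; _/_; _⊔_; ∣_∣; _≤_)
open import Data.Fin using (Fin)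
open import Data.Fin.Subset using (Subset; inside; outside; _∩_; _∪_; ∁; ⊤)
open import Data.Fin.Subset.Properties using (_∈?_)
open import Data.Vec using (Vec; []; _∷_)
import Data.Vec as Vec
open import Data.List using (List; []; _∷_; map; length; filter; concatMap; allFin; foldr)

ℕ→ℚ : ℕ → ℚ
ℕ→ℚ n = + n / 1

sumℚ : List ℚ → ℚ
sumℚ = foldr _+_ 0ℚ

-- uniform average of a list (counting multiplicities); the empty list gets 0
-- (never used: all averaged lists in the statement are nonempty)
avg : List ℚ → ℚ
avg xs with length xs
... | zero  = 0ℚ
... | suc m = sumℚ xs * (+ 1 / suc m)

-- maximum of a list of nonnegative rationals (0 for the empty list)
maxℚ : List ℚ → ℚ
maxℚ = foldr _⊔_ 0ℚ

allSubsets : (n : ℕ) → List (Subset n)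
allSubsets zero    = [] ∷ []
allSubsets (suc n) = concatMap (λ s → (outside ∷ s) ∷ (inside ∷ s) ∷ []) (allSubsets n)

SetFn : ℕ → Set
SetFn n = Subset n → ℚ

OneModular : {n : ℕ} → SetFn n → Set
OneModular f = ∀ S T → ∣ f S + f T - f (S ∪ T) - f (S ∩ T) ∣ ≤ ℕ→ℚ 1

linear : {n : ℕ} → ℚ → (Fin n → ℚ) → SetFn n
linear {n} c₀ c S = c₀ + sumℚ (map c (filter (λ i → i ∈? S) (allFin n)))

dist : {n : ℕ} → SetFn n → SetFn n → ℚ
dist {n} f g = maxℚ (map (λ S → ∣ f S - g S ∣) (allSubsets n))

zeroFn : {n : ℕ} → SetFn n
zeroFn _ = 0ℚ

ClosestLinearIsZero : {n : ℕ} → SetFn n → Set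
ClosestLinearIsZero {n} f = ∀ (c₀ : ℚ) (c : Fin n → ℚ) → dist f zeroFn ≤ dist f (linear c₀ c)

maxAbs : {n : ℕ} → SetFn n → ℚ
maxAbs {n} f = maxℚ (map (λ S → ∣ f S ∣) (allSubsets n))

degree : {n m : ℕ} → (Fin m → Subset n) → Fin n → ℕ
degree {n} {m} P i = length (filter (λ j → i ∈? P j) (allFin m))

allTuples : (ℓ m : ℕ) → List (Vec (Fin m) ℓ)
allTuples zero    m = [] ∷ []
allTuples (suc ℓ) m = concatMap (λ t → map (λ j → j ∷ t) (allFin m)) (allTuples ℓ m)

-- intersection of the sets indexed by a tuple (for ℓ ≥ 1 this is P_{t1} ∩ … ∩ P_{tℓ})
⋂tuple : {n m ℓ : ℕ} → (Fin m → Subset n) → Vec (Fin m) ℓ → Subset n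
⋂tuple P t = Vec.foldr _ (λ j S → P j ∩ S) ⊤ t

deficit : {n : ℕ} → SetFn n → Subset n → ℚ
deficit f S = maxAbs f - f S

surplus : {n : ℕ} → SetFn n → Subset n → ℚ
surplus f S = f S + maxAbs f

complements : {n m : ℕ} → (Fin m → Subset n) → (Fin m → Subset n)
complements P j = ∁ (P j)

dℓ : {n m : ℕ} → SetFn n → (Fin m → Subset n) → ℕ → ℚ
dℓ {m = m} f P ℓ = avg (map (λ t → deficit f (⋂tuple P t)) (allTuples ℓ m))

sℓ : {n m : ℕ} → SetFn n → (Fin m → Subset n) → ℕ → ℚ
sℓ {m = m} f N ℓ = avg (map (λ t → surplus f (⋂tuple N t)) (allTuples ℓ m))

-- Write L t for the deficit of the intersection of the positive sets indexed by the tuple t plus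
-- the surplus of the intersection of the corresponding negative sets, so that d_ℓ + s_ℓ is the
-- mean of L over ℓ-tuples. Since f is 1-modular and |f| ≤ M, deficit and surplus are subadditive
-- up to 1 under intersection, whence L (s ++ t) ≤ L s + L t + 2; as every prefix and every suffix
-- occurs equally often, the mean over (k + ℓ)-tuples is at most the means over k- and ℓ-tuples
-- plus 2. For pairs, four instances of 1-modularity, two of them on complementary sets, give
-- 2 L (j , j′) ≤ L j + L j′ + 4, so the mean over pairs is at most 3, while the mean over single
-- sets is at most 1 by hypothesis. Peeling off pairs yields 1 + 5 (ℓ − 1) / 2 for odd ℓ and
-- 3 + 5 (ℓ − 2) / 2 for even ℓ.
module Submission where

open import Defs
open import Data.Nat as ℕ using (ℕ; _%_)
open import Data.Product using (_×_)
open import Data.Integer using (+_)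
open import Data.Rational using (ℚ; _+_; _-_; _≤_; _/_)
open import Data.Fin using (Fin)
open import Data.Fin.Subset using (Subset)
open import Data.List using (map; allFin)
open import Relation.Binary.PropositionalEquality using (_≡_)

open import Level using (0ℓ)
open import Function using (_∘_)
open import Data.Nat using (zero; suc; _<_; z≤n; s≤s)
import Data.Nat.Properties as ℕP
import Data.Nat.Tactic.RingSolver as ℕSolver
import Data.Integer as ℤ
import Data.Integer.Properties as ℤP
import Data.Integer.Tactic.RingSolver as ℤSolver
open import Data.Rational using (0ℚ; 1ℚ; ½; _*_; -_; 1/_; ∣_∣; mkℚ; toℚᵘ; NonNegative)
import Data.Rational.Properties as ℚP
open import Data.Rational.Unnormalised using (mkℚᵘ; *≡*)
  renaming (_+_ to _+ᵘ_; _≃_ to _≃ᵘ_)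
import Data.Rational.Unnormalised.Properties as ℚᵘP
open import Data.Nat.Coprimality using (1-coprimeTo) renaming (sym to coprime-sym)
open import Data.Fin.Subset using (_∩_; _∪_; ∁; ⊤; ⊥; inside; outside)
open import Data.Fin.Subset.Properties
  using (∩-assoc; ∩-identityˡ; ∩-identityʳ; ∩-inverseʳ; p∪∁p≡⊤; ∪-∩-booleanAlgebra)
import Algebra.Lattice.Properties.BooleanAlgebra as BooleanAlgebraProperties
open import Data.List using (List; []; _∷_; length; concatMap)
import Data.List as List
import Data.List.Properties as ListP
open import Data.List.Membership.Propositional using (_∈_)
open import Data.List.Membership.Propositional.Properties using (∈-map⁺; ∈-concatMap⁺)
open import Data.List.Relation.Unary.Any using (here; there)
import Data.List.Relation.Unary.Any as Any
open import Data.Vec using (Vec; []; _∷_; _++_; take; drop)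
open import Data.Vec.Properties using (take++drop≡id)
open import Data.Product using (_,_)
open import Data.Sum using (inj₁; inj₂)
open import Relation.Binary.PropositionalEquality
  using (refl; sym; trans; cong; cong₂; subst; subst₂; module ≡-Reasoning)
open import Relation.Nullary.Decidable using (dec⇒maybe)
open import Tactic.RingSolver using (solve-∀)
open import Tactic.RingSolver.Core.AlmostCommutativeRing
  using (AlmostCommutativeRing; fromCommutativeRing)

ℚ-ring : AlmostCommutativeRing 0ℓ 0ℓ
ℚ-ring = fromCommutativeRing ℚP.+-*-commutativeRing (λ x → dec⇒maybe (0ℚ ℚP.≟ x))

≤-shift : ∀ {a b x y : ℚ} → a ≤ b → x - a ≡ y - b → x ≤ y
≤-shift {a} {b} {x} {y} a≤b eq = begin
  x            ≡⟨ split x a ⟩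
  a + (x - a)  ≤⟨ ℚP.+-monoˡ-≤ (x - a) a≤b ⟩
  b + (x - a)  ≡⟨ cong (λ z → b + z) eq ⟩
  b + (y - b)  ≡⟨ sym (split y b) ⟩
  y            ∎
  where
  open ℚP.≤-Reasoning
  split : ∀ x a → x ≡ a + (x - a)
  split = solve-∀ ℚ-ring

p≤∣p∣ : ∀ p → p ≤ ∣ p ∣
p≤∣p∣ p with ℚP.≤-total 0ℚ p
... | inj₁ 0≤p = ℚP.≤-reflexive (sym (ℚP.0≤p⇒∣p∣≡p 0≤p))
... | inj₂ p≤0 = ℚP.≤-trans p≤0 (ℚP.0≤∣p∣ p)

-p≤∣p∣ : ∀ p → - p ≤ ∣ p ∣
-p≤∣p∣ p = subst (- p ≤_) (ℚP.∣-p∣≡∣p∣ p) (p≤∣p∣ (- p))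

toℚᵘ-ℕ→ℚ : ∀ n → toℚᵘ (ℕ→ℚ n) ≃ᵘ mkℚᵘ (+ n) 0
toℚᵘ-ℕ→ℚ n = ℚP.toℚᵘ-fromℚᵘ (mkℚᵘ (+ n) 0)

ℕ→ℚ-suc : ∀ n → ℕ→ℚ (suc n) ≡ 1ℚ + ℕ→ℚ n
ℕ→ℚ-suc n = ℚP.toℚᵘ-injective (begin
  toℚᵘ (ℕ→ℚ (suc n))
    ≈⟨ toℚᵘ-ℕ→ℚ (suc n) ⟩
  mkℚᵘ (+ suc n) 0
    ≈⟨ *≡* (cross-multiplied (+ n)) ⟩
  mkℚᵘ (+ 1) 0 +ᵘ mkℚᵘ (+ n) 0
    ≈⟨ ℚᵘP.+-cong (ℚᵘP.≃-sym (toℚᵘ-ℕ→ℚ 1)) (ℚᵘP.≃-sym (toℚᵘ-ℕ→ℚ n)) ⟩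
  toℚᵘ 1ℚ +ᵘ toℚᵘ (ℕ→ℚ n)
    ≈⟨ ℚᵘP.≃-sym (ℚP.toℚᵘ-homo-+ 1ℚ (ℕ→ℚ n)) ⟩
  toℚᵘ (1ℚ + ℕ→ℚ n)
    ∎)
  where
  open ℚᵘP.≃-Reasoning
  cross-multiplied : ∀ i → (+ 1 ℤ.+ i) ℤ.* + 1 ≡ (+ 1 ℤ.* + 1 ℤ.+ i ℤ.* + 1) ℤ.* + 1
  cross-multiplied = ℤSolver.solve-∀

ℕ→ℚ-+ : ∀ a b → ℕ→ℚ (a ℕ.+ b) ≡ ℕ→ℚ a + ℕ→ℚ b
ℕ→ℚ-+ zero    b = sym (ℚP.+-identityˡ (ℕ→ℚ b))
ℕ→ℚ-+ (suc a) b = begin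
  ℕ→ℚ (suc (a ℕ.+ b))     ≡⟨ ℕ→ℚ-suc (a ℕ.+ b) ⟩
  1ℚ + ℕ→ℚ (a ℕ.+ b)      ≡⟨ cong (λ z → 1ℚ + z) (ℕ→ℚ-+ a b) ⟩
  1ℚ + (ℕ→ℚ a + ℕ→ℚ b)    ≡⟨ sym (ℚP.+-assoc 1ℚ (ℕ→ℚ a) (ℕ→ℚ b)) ⟩
  1ℚ + ℕ→ℚ a + ℕ→ℚ b      ≡⟨ cong (λ z → z + ℕ→ℚ b) (sym (ℕ→ℚ-suc a)) ⟩
  ℕ→ℚ (suc a) + ℕ→ℚ b     ∎
  where open ≡-Reasoning

ℕ→ℚ-* : ∀ a b → ℕ→ℚ (a ℕ.* b) ≡ ℕ→ℚ a * ℕ→ℚ b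
ℕ→ℚ-* zero    b = sym (ℚP.*-zeroˡ (ℕ→ℚ b))
ℕ→ℚ-* (suc a) b = begin
  ℕ→ℚ (b ℕ.+ a ℕ.* b)           ≡⟨ ℕ→ℚ-+ b (a ℕ.* b) ⟩
  ℕ→ℚ b + ℕ→ℚ (a ℕ.* b)         ≡⟨ cong (λ z → ℕ→ℚ b + z) (ℕ→ℚ-* a b) ⟩
  ℕ→ℚ b + ℕ→ℚ a * ℕ→ℚ b         ≡⟨ factor (ℕ→ℚ a) (ℕ→ℚ b) ⟩
  (1ℚ + ℕ→ℚ a) * ℕ→ℚ b          ≡⟨ cong (_* ℕ→ℚ b) (sym (ℕ→ℚ-suc a)) ⟩
  ℕ→ℚ (suc a) * ℕ→ℚ b           ∎
  where
  open ≡-Reasoning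
  factor : ∀ x y → y + x * y ≡ (1ℚ + x) * y
  factor = solve-∀ ℚ-ring

ℕ→ℚ-*-mono-≤ : ∀ n {p q} → p ≤ q → ℕ→ℚ n * p ≤ ℕ→ℚ n * q
ℕ→ℚ-*-mono-≤ n = ℚP.*-monoˡ-≤-nonNeg (ℕ→ℚ n) {{ℚP.normalize-nonNeg n 1}}

ℕ→ℚ-*-reciprocal : ∀ n → ℕ→ℚ (suc n) * (+ 1 / suc n) ≡ 1ℚ
ℕ→ℚ-*-reciprocal n = begin
  ℕ→ℚ (suc n) * (+ 1 / suc n)  ≡⟨ cong₂ _*_ (ℚP.normalize-coprime (coprime-sym (1-coprimeTo (suc n))))
                                            (ℚP.normalize-coprime (1-coprimeTo (suc n))) ⟩
  p * 1/ p                     ≡⟨ ℚP.*-inverseʳ p ⟩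
  1ℚ                           ∎
  where
  open ≡-Reasoning
  p : ℚ
  p = mkℚ (+ suc n) 0 (coprime-sym (1-coprimeTo (suc n)))

[x+2y]/2≡x/2+y : ∀ x y → (+ (x ℕ.+ 2 ℕ.* y)) / 2 ≡ (+ x) / 2 + ℕ→ℚ y
[x+2y]/2≡x/2+y x y = ℚP.toℚᵘ-injective (begin
  toℚᵘ ((+ (x ℕ.+ 2 ℕ.* y)) / 2)
    ≈⟨ ℚP.toℚᵘ-fromℚᵘ (mkℚᵘ (+ (x ℕ.+ 2 ℕ.* y)) 1) ⟩
  mkℚᵘ (+ (x ℕ.+ 2 ℕ.* y)) 1
    ≈⟨ *≡* (trans (cong (λ z → (+ x ℤ.+ z) ℤ.* + 2) (ℤP.pos-* 2 y)) (cross-multiplied (+ x) (+ y))) ⟩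
  mkℚᵘ (+ x) 1 +ᵘ mkℚᵘ (+ y) 0
    ≈⟨ ℚᵘP.+-cong (ℚᵘP.≃-sym (ℚP.toℚᵘ-fromℚᵘ (mkℚᵘ (+ x) 1))) (ℚᵘP.≃-sym (toℚᵘ-ℕ→ℚ y)) ⟩
  toℚᵘ ((+ x) / 2) +ᵘ toℚᵘ (ℕ→ℚ y)
    ≈⟨ ℚᵘP.≃-sym (ℚP.toℚᵘ-homo-+ ((+ x) / 2) (ℕ→ℚ y)) ⟩
  toℚᵘ ((+ x) / 2 + ℕ→ℚ y)
    ∎)
  where
  open ℚᵘP.≃-Reasoning
  cross-multiplied : ∀ i j →
    (i ℤ.+ + 2 ℤ.* j) ℤ.* + 2 ≡ (i ℤ.* + 1 ℤ.+ j ℤ.* + 2) ℤ.* + 2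
  cross-multiplied = ℤSolver.solve-∀

∑ : {A : Set} → List A → (A → ℚ) → ℚ
∑ xs g = sumℚ (map g xs)

syntax ∑ xs (λ x → e) = ∑[ x ← xs ] e

module _ {A : Set} where

  ∑-cong : ∀ {g h : A → ℚ} → (∀ x → g x ≡ h x) → ∀ xs → ∑ xs g ≡ ∑ xs h
  ∑-cong g≡h xs = cong sumℚ (ListP.map-cong g≡h xs)

  ∑-mono-≤ : ∀ {g h : A → ℚ} → (∀ x → g x ≤ h x) → ∀ xs → ∑ xs g ≤ ∑ xs h
  ∑-mono-≤ g≤h []       = ℚP.≤-refl
  ∑-mono-≤ g≤h (x ∷ xs) = ℚP.+-mono-≤ (g≤h x) (∑-mono-≤ g≤h xs)

  ∑-+ : ∀ (xs : List A) g h → ∑[ x ← xs ] (g x + h x) ≡ ∑ xs g + ∑ xs h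
  ∑-+ []       g h = refl
  ∑-+ (x ∷ xs) g h = trans (cong (λ z → (g x + h x) + z) (∑-+ xs g h))
                           (interchange (g x) (h x) (∑ xs g) (∑ xs h))
    where
    interchange : ∀ a b c d → (a + b) + (c + d) ≡ (a + c) + (b + d)
    interchange = solve-∀ ℚ-ring

  ∑-*ˡ : ∀ r (xs : List A) g → ∑[ x ← xs ] (r * g x) ≡ r * ∑ xs g
  ∑-*ˡ r []       g = sym (ℚP.*-zeroʳ r)
  ∑-*ˡ r (x ∷ xs) g = trans (cong (λ z → r * g x + z) (∑-*ˡ r xs g))
                            (sym (ℚP.*-distribˡ-+ r (g x) (∑ xs g)))

  ∑-const : ∀ c (xs : List A) → ∑[ _ ← xs ] c ≡ ℕ→ℚ (length xs) * c
  ∑-const c []       = sym (ℚP.*-zeroˡ c)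
  ∑-const c (x ∷ xs) = begin
    c + ∑[ _ ← xs ] c               ≡⟨ cong (λ z → c + z) (∑-const c xs) ⟩
    c + ℕ→ℚ (length xs) * c         ≡⟨ factor c (ℕ→ℚ (length xs)) ⟩
    (1ℚ + ℕ→ℚ (length xs)) * c      ≡⟨ cong (_* c) (sym (ℕ→ℚ-suc (length xs))) ⟩
    ℕ→ℚ (suc (length xs)) * c       ∎
    where
    open ≡-Reasoning
    factor : ∀ c l → c + l * c ≡ (1ℚ + l) * c
    factor = solve-∀ ℚ-ring

  ∑-++ : ∀ (xs ys : List A) g → ∑ (xs List.++ ys) g ≡ ∑ xs g + ∑ ys g
  ∑-++ []       ys g = sym (ℚP.+-identityˡ (∑ ys g))
  ∑-++ (x ∷ xs) ys g = trans (cong (λ z → g x + z) (∑-++ xs ys g))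
                             (sym (ℚP.+-assoc (g x) (∑ xs g) (∑ ys g)))

module _ {A B : Set} where

  ∑-map : ∀ (h : A → B) xs (g : B → ℚ) → ∑ (map h xs) g ≡ ∑[ x ← xs ] g (h x)
  ∑-map h xs g = cong sumℚ (sym (ListP.map-∘ xs))

  ∑-concatMap : ∀ (K : A → List B) xs (g : B → ℚ) →
                ∑ (concatMap K xs) g ≡ ∑[ x ← xs ] ∑ (K x) g
  ∑-concatMap K []       g = refl
  ∑-concatMap K (x ∷ xs) g = trans (∑-++ (K x) (concatMap K xs) g)
                                   (cong (λ z → ∑ (K x) g + z) (∑-concatMap K xs g))

  length-concatMap : ∀ (K : A → List B) {k} → (∀ x → length (K x) ≡ k) →
                     ∀ xs → length (concatMap K xs) ≡ length xs ℕ.* k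
  length-concatMap K ∣K∣≡k []       = refl
  length-concatMap K ∣K∣≡k (x ∷ xs) =
    trans (ListP.length-++ (K x)) (cong₂ ℕ._+_ (∣K∣≡k x) (length-concatMap K ∣K∣≡k xs))

Mean≤ : {A : Set} → List A → (A → ℚ) → ℚ → Set
Mean≤ xs g c = ∑ xs g ≤ ℕ→ℚ (length xs) * c

module _ {A : Set} where

  avg-map : ∀ (g : A → ℚ) x xs →
            avg (map g (x ∷ xs)) ≡ ∑ (x ∷ xs) g * (+ 1 / suc (length xs))
  avg-map g x xs = cong (λ l → ∑ (x ∷ xs) g * (+ 1 / suc l)) (ListP.length-map g xs)

  avg-map-+ : ∀ xs (g h : A → ℚ) →
              avg (map g xs) + avg (map h xs) ≡ avg (map (λ x → g x + h x) xs)
  avg-map-+ []       g h = refl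
  avg-map-+ (x ∷ xs) g h = begin
    avg (map g (x ∷ xs)) + avg (map h (x ∷ xs))  ≡⟨ cong₂ _+_ (avg-map g x xs) (avg-map h x xs) ⟩
    ∑ (x ∷ xs) g * r + ∑ (x ∷ xs) h * r           ≡⟨ sym (ℚP.*-distribʳ-+ r (∑ (x ∷ xs) g) _) ⟩
    (∑ (x ∷ xs) g + ∑ (x ∷ xs) h) * r             ≡⟨ cong (_* r) (sym (∑-+ (x ∷ xs) g h)) ⟩
    ∑[ y ← x ∷ xs ] (g y + h y) * r               ≡⟨ sym (avg-map (λ y → g y + h y) x xs) ⟩
    avg (map (λ y → g y + h y) (x ∷ xs))          ∎
    where
    open ≡-Reasoning
    r : ℚ
    r = + 1 / suc (length xs)

  avg⇒Mean≤ : ∀ xs (g : A → ℚ) {c} → avg (map g xs) ≤ c → Mean≤ xs g c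
  avg⇒Mean≤ []       g {c} _   = ℚP.≤-reflexive (sym (ℚP.*-zeroˡ c))
  avg⇒Mean≤ (x ∷ xs) g {c} avg≤c = begin
    S                  ≡⟨ sym (ℚP.*-identityʳ S) ⟩
    S * 1ℚ             ≡⟨ cong (S *_) (sym (ℕ→ℚ-*-reciprocal (length xs))) ⟩
    S * (N * r)        ≡⟨ rearrange S N r ⟩
    N * (S * r)        ≤⟨ ℕ→ℚ-*-mono-≤ (suc (length xs)) (subst (_≤ c) (avg-map g x xs) avg≤c) ⟩
    N * c              ∎
    where
    open ℚP.≤-Reasoning
    S N r : ℚ
    S = ∑ (x ∷ xs) g
    N = ℕ→ℚ (suc (length xs))
    r = + 1 / suc (length xs)
    rearrange : ∀ S N r → S * (N * r) ≡ N * (S * r)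
    rearrange = solve-∀ ℚ-ring

  Mean≤⇒avg : ∀ xs (g : A → ℚ) {c} → 0 < length xs → Mean≤ xs g c → avg (map g xs) ≤ c
  Mean≤⇒avg (x ∷ xs) g {c} _ mean≤c = begin
    avg (map g (x ∷ xs))  ≡⟨ avg-map g x xs ⟩
    ∑ (x ∷ xs) g * r      ≤⟨ ℚP.*-monoʳ-≤-nonNeg r {{ℚP.normalize-nonNeg 1 (suc (length xs))}} mean≤c ⟩
    (N * c) * r           ≡⟨ rearrange N c r ⟩
    c * (N * r)           ≡⟨ cong (c *_) (ℕ→ℚ-*-reciprocal (length xs)) ⟩
    c * 1ℚ                ≡⟨ ℚP.*-identityʳ c ⟩
    c                     ∎
    where
    open ℚP.≤-Reasoning
    N r : ℚ
    N = ℕ→ℚ (suc (length xs))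
    r = + 1 / suc (length xs)
    rearrange : ∀ N c r → (N * c) * r ≡ c * (N * r)
    rearrange = solve-∀ ℚ-ring

module _ {m : ℕ} where

  ∑-allTuples-zero : ∀ (g : Vec (Fin m) 0 → ℚ) → ∑ (allTuples 0 m) g ≡ g []
  ∑-allTuples-zero g = ℚP.+-identityʳ (g [])

  ∑-allTuples-suc : ∀ ℓ (g : Vec (Fin m) (suc ℓ) → ℚ) →
                    ∑ (allTuples (suc ℓ) m) g
                      ≡ ∑[ t ← allTuples ℓ m ] ∑[ j ← allFin m ] g (j ∷ t)
  ∑-allTuples-suc ℓ g = trans (∑-concatMap (λ t → map (_∷ t) (allFin m)) (allTuples ℓ m) g)
                              (∑-cong (λ t → ∑-map (_∷ t) (allFin m) g) (allTuples ℓ m))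

  length-allTuples-suc : ∀ ℓ →
    length (allTuples (suc ℓ) m) ≡ length (allTuples ℓ m) ℕ.* length (allFin m)
  length-allTuples-suc ℓ = length-concatMap (λ t → map (_∷ t) (allFin m))
                                            (λ t → ListP.length-map (_∷ t) (allFin m)) (allTuples ℓ m)

  length-allTuples-+ : ∀ k ℓ →
    length (allTuples (k ℕ.+ ℓ) m) ≡ length (allTuples k m) ℕ.* length (allTuples ℓ m)
  length-allTuples-+ zero    ℓ = sym (ℕP.+-identityʳ _)
  length-allTuples-+ (suc k) ℓ = begin
    length (allTuples (suc k ℕ.+ ℓ) m)
      ≡⟨ length-allTuples-suc (k ℕ.+ ℓ) ⟩
    length (allTuples (k ℕ.+ ℓ) m) ℕ.* length (allFin m)
      ≡⟨ cong (ℕ._* length (allFin m)) (length-allTuples-+ k ℓ) ⟩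
    length (allTuples k m) ℕ.* length (allTuples ℓ m) ℕ.* length (allFin m)
      ≡⟨ swap (length (allTuples k m)) (length (allTuples ℓ m)) (length (allFin m)) ⟩
    length (allTuples k m) ℕ.* length (allFin m) ℕ.* length (allTuples ℓ m)
      ≡⟨ cong (ℕ._* length (allTuples ℓ m)) (sym (length-allTuples-suc k)) ⟩
    length (allTuples (suc k) m) ℕ.* length (allTuples ℓ m)
      ∎
    where
    open ≡-Reasoning
    swap : ∀ a b c → a ℕ.* b ℕ.* c ≡ a ℕ.* c ℕ.* b
    swap = ℕSolver.solve-∀

  #tuples : ℕ → ℚ
  #tuples ℓ = ℕ→ℚ (length (allTuples ℓ m))

  #tuples-suc : ∀ k → #tuples (suc k) ≡ #tuples k * ℕ→ℚ (length (allFin m))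
  #tuples-suc k = trans (cong ℕ→ℚ (length-allTuples-suc k))
                        (ℕ→ℚ-* (length (allTuples k m)) (length (allFin m)))

  ∑-take : ∀ k ℓ (g : Vec (Fin m) k → ℚ) →
           ∑[ t ← allTuples (k ℕ.+ ℓ) m ] g (take k t) ≡ #tuples ℓ * ∑ (allTuples k m) g
  ∑-take zero    ℓ g = begin
    ∑[ _ ← allTuples ℓ m ] g []       ≡⟨ ∑-const (g []) (allTuples ℓ m) ⟩
    #tuples ℓ * g []                  ≡⟨ cong (#tuples ℓ *_) (sym (∑-allTuples-zero g)) ⟩
    #tuples ℓ * ∑ (allTuples 0 m) g   ∎
    where open ≡-Reasoning
  ∑-take (suc k) ℓ g = begin
    ∑[ t ← allTuples (suc k ℕ.+ ℓ) m ] g (take (suc k) t)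
      ≡⟨ ∑-allTuples-suc (k ℕ.+ ℓ) (g ∘ take (suc k)) ⟩
    ∑[ t ← allTuples (k ℕ.+ ℓ) m ] ∑[ j ← allFin m ] g (j ∷ take k t)
      ≡⟨ ∑-take k ℓ (λ s → ∑[ j ← allFin m ] g (j ∷ s)) ⟩
    #tuples ℓ * ∑[ s ← allTuples k m ] ∑[ j ← allFin m ] g (j ∷ s)
      ≡⟨ cong (#tuples ℓ *_) (sym (∑-allTuples-suc k g)) ⟩
    #tuples ℓ * ∑ (allTuples (suc k) m) g
      ∎
    where open ≡-Reasoning

  ∑-drop : ∀ k ℓ (g : Vec (Fin m) ℓ → ℚ) →
           ∑[ t ← allTuples (k ℕ.+ ℓ) m ] g (drop k t) ≡ #tuples k * ∑ (allTuples ℓ m) g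
  ∑-drop zero    ℓ g = sym (ℚP.*-identityˡ (∑ (allTuples ℓ m) g))
  ∑-drop (suc k) ℓ g = begin
    ∑[ t ← allTuples (suc k ℕ.+ ℓ) m ] g (drop (suc k) t)
      ≡⟨ ∑-allTuples-suc (k ℕ.+ ℓ) (g ∘ drop (suc k)) ⟩
    ∑[ t ← allTuples (k ℕ.+ ℓ) m ] ∑[ _ ← allFin m ] g (drop k t)
      ≡⟨ ∑-cong (λ t → ∑-const (g (drop k t)) (allFin m)) (allTuples (k ℕ.+ ℓ) m) ⟩
    ∑[ t ← allTuples (k ℕ.+ ℓ) m ] (#fin * g (drop k t))
      ≡⟨ ∑-*ˡ #fin (allTuples (k ℕ.+ ℓ) m) (g ∘ drop k) ⟩
    #fin * ∑[ t ← allTuples (k ℕ.+ ℓ) m ] g (drop k t)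
      ≡⟨ cong (#fin *_) (∑-drop k ℓ g) ⟩
    #fin * (#tuples k * ∑ (allTuples ℓ m) g)
      ≡⟨ rearrange #fin (#tuples k) (∑ (allTuples ℓ m) g) ⟩
    (#tuples k * #fin) * ∑ (allTuples ℓ m) g
      ≡⟨ cong (_* ∑ (allTuples ℓ m) g) (sym (#tuples-suc k)) ⟩
    #tuples (suc k) * ∑ (allTuples ℓ m) g
      ∎
    where
    open ≡-Reasoning
    #fin : ℚ
    #fin = ℕ→ℚ (length (allFin m))
    rearrange : ∀ a b c → a * (b * c) ≡ (b * a) * c
    rearrange = solve-∀ ℚ-ring

  #tuples-*-mono-≤ : ∀ ℓ {p q} → p ≤ q → #tuples ℓ * p ≤ #tuples ℓ * q
  #tuples-*-mono-≤ ℓ = ℕ→ℚ-*-mono-≤ (length (allTuples ℓ m))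

  #tuples-+ : ∀ k ℓ → #tuples (k ℕ.+ ℓ) ≡ #tuples k * #tuples ℓ
  #tuples-+ k ℓ = trans (cong ℕ→ℚ (length-allTuples-+ k ℓ))
                        (ℕ→ℚ-* (length (allTuples k m)) (length (allTuples ℓ m)))

  mean-split : ∀ k ℓ {g : ∀ {i} → Vec (Fin m) i → ℚ} {w c a b} .{{_ : NonNegative w}} →
               (∀ t → g t ≤ w * (g (take k t) + g (drop k {ℓ} t)) + c) →
               Mean≤ (allTuples k m) g a → Mean≤ (allTuples ℓ m) g b →
               Mean≤ (allTuples (k ℕ.+ ℓ) m) g (w * (a + b) + c)
  mean-split k ℓ {g} {w} {c} {a} {b} split mean-a mean-b = begin
    ∑ T g
      ≤⟨ ∑-mono-≤ split T ⟩
    ∑[ t ← T ] (w * (g (take k t) + g (drop k t)) + c)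
      ≡⟨ linearity ⟩
    w * (L * ∑ (allTuples k m) g + K * ∑ (allTuples ℓ m) g) + #tuples (k ℕ.+ ℓ) * c
      ≤⟨ ℚP.+-monoˡ-≤ (#tuples (k ℕ.+ ℓ) * c)
           (ℚP.*-monoˡ-≤-nonNeg w
             (ℚP.+-mono-≤ (#tuples-*-mono-≤ ℓ mean-a) (#tuples-*-mono-≤ k mean-b))) ⟩
    w * (L * (K * a) + K * (L * b)) + #tuples (k ℕ.+ ℓ) * c
      ≡⟨ cong (λ N → w * (L * (K * a) + K * (L * b)) + N * c) (#tuples-+ k ℓ) ⟩
    w * (L * (K * a) + K * (L * b)) + (K * L) * c
      ≡⟨ collect w K L a b c ⟩
    (K * L) * (w * (a + b) + c)
      ≡⟨ cong (_* (w * (a + b) + c)) (sym (#tuples-+ k ℓ)) ⟩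
    #tuples (k ℕ.+ ℓ) * (w * (a + b) + c)
      ∎
    where
    open ℚP.≤-Reasoning
    T : List (Vec (Fin m) (k ℕ.+ ℓ))
    T = allTuples (k ℕ.+ ℓ) m
    K L : ℚ
    K = #tuples k
    L = #tuples ℓ
    linearity : ∑[ t ← T ] (w * (g (take k t) + g (drop k t)) + c)
                ≡ w * (L * ∑ (allTuples k m) g + K * ∑ (allTuples ℓ m) g) + #tuples (k ℕ.+ ℓ) * c
    linearity =
      trans (∑-+ T (λ t → w * (g (take k t) + g (drop k t))) (λ _ → c))
            (cong₂ _+_ (trans (∑-*ˡ w T (λ t → g (take k t) + g (drop k t)))
                              (cong (w *_) (trans (∑-+ T (g ∘ take k) (g ∘ drop k))
                                                  (cong₂ _+_ (∑-take k ℓ g) (∑-drop k ℓ g)))))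
                       (∑-const c T))
    collect : ∀ w K L a b c →
      w * (L * (K * a) + K * (L * b)) + (K * L) * c ≡ (K * L) * (w * (a + b) + c)
    collect = solve-∀ ℚ-ring

  Mean≤-allTuples-1 : ∀ {g : Vec (Fin m) 1 → ℚ} {c} →
                      Mean≤ (allFin m) (λ j → g (j ∷ [])) c → Mean≤ (allTuples 1 m) g c
  Mean≤-allTuples-1 {g} {c} mean≤c = begin
    ∑ (allTuples 1 m) g                 ≡⟨ ∑-allTuples-suc 0 g ⟩
    ∑[ j ← allFin m ] g (j ∷ []) + 0ℚ  ≡⟨ ℚP.+-identityʳ _ ⟩
    ∑[ j ← allFin m ] g (j ∷ [])       ≤⟨ mean≤c ⟩
    ℕ→ℚ (length (allFin m)) * c         ≡⟨ cong (_* c) (sym (#tuples-1)) ⟩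
    #tuples 1 * c                       ∎
    where
    open ℚP.≤-Reasoning
    #tuples-1 : #tuples 1 ≡ ℕ→ℚ (length (allFin m))
    #tuples-1 = trans (#tuples-suc 0) (ℚP.*-identityˡ _)

allTuples-nonempty : ∀ {m} ℓ → 0 < length (allTuples ℓ (suc m))
allTuples-nonempty zero    = s≤s z≤n
allTuples-nonempty (suc ℓ) =
  subst (0 <_) (sym (length-allTuples-suc ℓ)) (ℕP.*-mono-< (allTuples-nonempty ℓ) (s≤s z≤n))

⋂tuple-++ : ∀ {n m k ℓ} (P : Fin m → Subset n) (s : Vec (Fin m) k) (t : Vec (Fin m) ℓ) →
            ⋂tuple P (s ++ t) ≡ ⋂tuple P s ∩ ⋂tuple P t
⋂tuple-++ P []      t = sym (∩-identityˡ (⋂tuple P t))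
⋂tuple-++ P (j ∷ s) t =
  trans (cong (P j ∩_) (⋂tuple-++ P s t)) (sym (∩-assoc (P j) (⋂tuple P s) (⋂tuple P t)))

≤-maxℚ : ∀ {x} xs → x ∈ xs → x ≤ maxℚ xs
≤-maxℚ (y ∷ ys) (here refl)  = ℚP.p≤p⊔q y (maxℚ ys)
≤-maxℚ (y ∷ ys) (there x∈ys) = ℚP.p≤q⇒p≤r⊔q y (≤-maxℚ ys x∈ys)

∈-allSubsets : ∀ {n} (S : Subset n) → S ∈ allSubsets n
∈-allSubsets []      = here refl
∈-allSubsets (b ∷ S) =
  ∈-concatMap⁺ (λ s → (outside ∷ s) ∷ (inside ∷ s) ∷ [])
               (Any.map (b∷S∈ b) (∈-allSubsets S))
  where
  b∷S∈ : ∀ b {s} → S ≡ s → (b ∷ S) ∈ (outside ∷ s) ∷ (inside ∷ s) ∷ []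
  b∷S∈ outside refl = here refl
  b∷S∈ inside  refl = there (here refl)

deficit+surplus : {n : ℕ} → SetFn n → Subset n → Subset n → ℚ
deficit+surplus f P N = deficit f P + surplus f N

module _ {n : ℕ} (f : SetFn n) where

  ∣f∣≤maxAbs : ∀ S → ∣ f S ∣ ≤ maxAbs f
  ∣f∣≤maxAbs S = ≤-maxℚ (map (λ S → ∣ f S ∣) (allSubsets n))
                        (∈-map⁺ (λ S → ∣ f S ∣) (∈-allSubsets S))

  f≤maxAbs : ∀ S → f S ≤ maxAbs f
  f≤maxAbs S = ℚP.≤-trans (p≤∣p∣ (f S)) (∣f∣≤maxAbs S)

  -f≤maxAbs : ∀ S → - f S ≤ maxAbs f
  -f≤maxAbs S = ℚP.≤-trans (-p≤∣p∣ (f S)) (∣f∣≤maxAbs S)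

module _ {n : ℕ} (f : SetFn n) (f-mod : OneModular f) where

  modular-upper : ∀ S T → f S + f T - f (S ∪ T) - f (S ∩ T) ≤ 1ℚ
  modular-upper S T = ℚP.≤-trans (p≤∣p∣ _) (f-mod S T)

  modular-lower : ∀ S T → - (f S + f T - f (S ∪ T) - f (S ∩ T)) ≤ 1ℚ
  modular-lower S T = ℚP.≤-trans (-p≤∣p∣ _) (f-mod S T)

  complement-upper : ∀ X → f X + f (∁ X) - f ⊤ - f ⊥ ≤ 1ℚ
  complement-upper X =
    subst₂ (λ U I → f X + f (∁ X) - f U - f I ≤ 1ℚ) (p∪∁p≡⊤ X) (∩-inverseʳ X)
           (modular-upper X (∁ X))

  complement-lower : ∀ X → - (f X + f (∁ X) - f ⊤ - f ⊥) ≤ 1ℚ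
  complement-lower X =
    subst₂ (λ U I → - (f X + f (∁ X) - f U - f I) ≤ 1ℚ) (p∪∁p≡⊤ X) (∩-inverseʳ X)
           (modular-lower X (∁ X))

  deficit-∩ : ∀ S T → deficit f (S ∩ T) ≤ deficit f S + deficit f T + 1ℚ
  deficit-∩ S T = ≤-shift (ℚP.+-mono-≤ (modular-upper S T) (f≤maxAbs f (S ∪ T)))
                          (slack (maxAbs f) (f S) (f T) (f (S ∪ T)) (f (S ∩ T)))
    where
    slack : ∀ M s t u i →
      (M - i) - ((s + t - u - i) + u) ≡ ((M - s) + (M - t) + 1ℚ) - (1ℚ + M)
    slack = solve-∀ ℚ-ring

  surplus-∩ : ∀ S T → surplus f (S ∩ T) ≤ surplus f S + surplus f T + 1ℚ
  surplus-∩ S T = ≤-shift (ℚP.+-mono-≤ (modular-lower S T) (-f≤maxAbs f (S ∪ T)))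
                          (slack (maxAbs f) (f S) (f T) (f (S ∪ T)) (f (S ∩ T)))
    where
    slack : ∀ M s t u i →
      (i + M) - (- (s + t - u - i) + - u) ≡ ((s + M) + (t + M) + 1ℚ) - (1ℚ + M)
    slack = solve-∀ ℚ-ring

  deficit+surplus-∩ : ∀ P P′ N N′ →
    deficit+surplus f (P ∩ P′) (N ∩ N′)
      ≤ deficit+surplus f P N + deficit+surplus f P′ N′ + ℕ→ℚ 2
  deficit+surplus-∩ P P′ N N′ = begin
    deficit f (P ∩ P′) + surplus f (N ∩ N′)
      ≤⟨ ℚP.+-mono-≤ (deficit-∩ P P′) (surplus-∩ N N′) ⟩
    (deficit f P + deficit f P′ + 1ℚ) + (surplus f N + surplus f N′ + 1ℚ)
      ≡⟨ regroup (deficit f P) (deficit f P′) (surplus f N) (surplus f N′) ⟩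
    (deficit f P + surplus f N) + (deficit f P′ + surplus f N′) + ℕ→ℚ 2
      ∎
    where
    open ℚP.≤-Reasoning
    regroup : ∀ a b c d → (a + b + 1ℚ) + (c + d + 1ℚ) ≡ (a + c) + (b + d) + (1ℚ + 1ℚ)
    regroup = solve-∀ ℚ-ring

  -- Sum of 1-modularity on (P, Q), (∁ P, ∁ Q), (P ∪ Q, ∁ P ∩ ∁ Q) and (P ∩ Q, ∁ P ∪ ∁ Q),
  -- in which the values of f on P ∪ Q, ∁ P ∪ ∁ Q, ⊤ and ⊥ cancel.
  deficit+surplus-∁-∩-doubled : ∀ P Q →
    let x = deficit+surplus f (P ∩ Q) (∁ P ∩ ∁ Q) in
    x + x ≤ deficit+surplus f P (∁ P) + deficit+surplus f Q (∁ Q) + (1ℚ + 1ℚ + 1ℚ + 1ℚ)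
  deficit+surplus-∁-∩-doubled P Q =
    summed (maxAbs f) (f P) (f Q) (f (∁ P)) (f (∁ Q)) (f (P ∪ Q)) (f (P ∩ Q))
           (f (∁ P ∪ ∁ Q)) (f (∁ P ∩ ∁ Q)) (f ⊤) (f ⊥)
           (modular-upper P Q)
           (modular-lower (∁ P) (∁ Q))
           (subst (λ Y → f (P ∪ Q) + f Y - f ⊤ - f ⊥ ≤ 1ℚ) ∁[P∪Q]
                  (complement-upper (P ∪ Q)))
           (subst (λ Y → - (f (P ∩ Q) + f Y - f ⊤ - f ⊥) ≤ 1ℚ) ∁[P∩Q]
                  (complement-lower (P ∩ Q)))
    where
    ∁[P∪Q] : ∁ (P ∪ Q) ≡ ∁ P ∩ ∁ Q
    ∁[P∪Q] = BooleanAlgebraProperties.deMorgan₂ (∪-∩-booleanAlgebra n) P Q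
    ∁[P∩Q] : ∁ (P ∩ Q) ≡ ∁ P ∪ ∁ Q
    ∁[P∩Q] = BooleanAlgebraProperties.deMorgan₁ (∪-∩-booleanAlgebra n) P Q
    summed : ∀ M p q p′ q′ u i u′ i′ t b →
      p + q - u - i ≤ 1ℚ → - (p′ + q′ - u′ - i′) ≤ 1ℚ →
      u + i′ - t - b ≤ 1ℚ → - (i + u′ - t - b) ≤ 1ℚ →
      ((M - i) + (i′ + M)) + ((M - i) + (i′ + M))
        ≤ ((M - p) + (p′ + M)) + ((M - q) + (q′ + M)) + (1ℚ + 1ℚ + 1ℚ + 1ℚ)
    summed M p q p′ q′ u i u′ i′ t b h₁ h₂ h₃ h₄ =
      ≤-shift (ℚP.+-mono-≤ (ℚP.+-mono-≤ (ℚP.+-mono-≤ h₁ h₂) h₃) h₄)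
              (cancel M p q p′ q′ u i u′ i′ t b)
      where
      cancel : ∀ M p q p′ q′ u i u′ i′ t b →
        ((M - i) + (i′ + M)) + ((M - i) + (i′ + M))
          - ((((p + q - u - i) + - (p′ + q′ - u′ - i′)) + (u + i′ - t - b))
             + - (i + u′ - t - b))
        ≡ ((M - p) + (p′ + M)) + ((M - q) + (q′ + M)) + (1ℚ + 1ℚ + 1ℚ + 1ℚ)
          - (1ℚ + 1ℚ + 1ℚ + 1ℚ)
      cancel = solve-∀ ℚ-ring

  deficit+surplus-∁-∩ : ∀ P Q →
    deficit+surplus f (P ∩ Q) (∁ P ∩ ∁ Q)
      ≤ ½ * (deficit+surplus f P (∁ P) + deficit+surplus f Q (∁ Q)) + ℕ→ℚ 2
  deficit+surplus-∁-∩ P Q = begin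
    x                                  ≡⟨ halve x ⟩
    ½ * (x + x)                        ≤⟨ ℚP.*-monoˡ-≤-nonNeg ½ (deficit+surplus-∁-∩-doubled P Q) ⟩
    ½ * (y + z + (1ℚ + 1ℚ + 1ℚ + 1ℚ))  ≡⟨ distribute y z ⟩
    ½ * (y + z) + ℕ→ℚ 2                ∎
    where
    open ℚP.≤-Reasoning
    x y z : ℚ
    x = deficit+surplus f (P ∩ Q) (∁ P ∩ ∁ Q)
    y = deficit+surplus f P (∁ P)
    z = deficit+surplus f Q (∁ Q)
    halve : ∀ x → x ≡ ½ * (x + x)
    halve = solve-∀ ℚ-ring
    distribute : ∀ y z → ½ * (y + z + (1ℚ + 1ℚ + 1ℚ + 1ℚ)) ≡ ½ * (y + z) + ℕ→ℚ 2
    distribute = solve-∀ ℚ-ring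

module _ {n m : ℕ} (f : SetFn n) (PS : Fin m → Subset n) where

  tupleLoad : ∀ {ℓ} → Vec (Fin m) ℓ → ℚ
  tupleLoad t = deficit+surplus f (⋂tuple PS t) (⋂tuple (complements PS) t)

  tupleLoad-[_] : ∀ j → tupleLoad (j ∷ []) ≡ deficit+surplus f (PS j) (∁ (PS j))
  tupleLoad-[ j ] = cong₂ (deficit+surplus f) (∩-identityʳ (PS j)) (∩-identityʳ (∁ (PS j)))

  module _ (f-mod : OneModular f) where

    tupleLoad-++ : ∀ {k ℓ} (s : Vec (Fin m) k) (t : Vec (Fin m) ℓ) →
                   tupleLoad (s ++ t) ≤ tupleLoad s + tupleLoad t + ℕ→ℚ 2
    tupleLoad-++ s t =
      subst₂ (λ P N → deficit+surplus f P N ≤ tupleLoad s + tupleLoad t + ℕ→ℚ 2)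
             (sym (⋂tuple-++ PS s t)) (sym (⋂tuple-++ (complements PS) s t))
             (deficit+surplus-∩ f f-mod _ _ _ _)

    tupleLoad-split : ∀ k {ℓ} (t : Vec (Fin m) (k ℕ.+ ℓ)) →
                      tupleLoad t ≤ 1ℚ * (tupleLoad (take k t) + tupleLoad (drop k t)) + ℕ→ℚ 2
    tupleLoad-split k t =
      subst₂ (λ u v → tupleLoad u ≤ v + ℕ→ℚ 2) (take++drop≡id k t)
             (sym (ℚP.*-identityˡ (tupleLoad (take k t) + tupleLoad (drop k t))))
             (tupleLoad-++ (take k t) (drop k t))

    tupleLoad-pair : ∀ (t : Vec (Fin m) 2) →
                     tupleLoad t ≤ ½ * (tupleLoad (take 1 t) + tupleLoad (drop 1 t)) + ℕ→ℚ 2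
    tupleLoad-pair (j ∷ j′ ∷ []) = begin
      tupleLoad (j ∷ j′ ∷ [])
        ≡⟨ cong₂ (λ P N → deficit+surplus f (PS j ∩ P) (∁ (PS j) ∩ N))
                 (∩-identityʳ (PS j′)) (∩-identityʳ (∁ (PS j′))) ⟩
      deficit+surplus f (PS j ∩ PS j′) (∁ (PS j) ∩ ∁ (PS j′))
        ≤⟨ deficit+surplus-∁-∩ f f-mod (PS j) (PS j′) ⟩
      ½ * (deficit+surplus f (PS j) (∁ (PS j)) + deficit+surplus f (PS j′) (∁ (PS j′))) + ℕ→ℚ 2
        ≡⟨ cong (λ z → ½ * z + ℕ→ℚ 2) (sym (cong₂ _+_ tupleLoad-[ j ] tupleLoad-[ j′ ])) ⟩
      ½ * (tupleLoad (j ∷ []) + tupleLoad (j′ ∷ [])) + ℕ→ℚ 2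
        ∎
      where open ℚP.≤-Reasoning

-- meanBound 0 is never used as a bound; its value −2 makes the even closed form hold at 0.
meanBound : ℕ → ℚ
meanBound zero          = - ℕ→ℚ 2
meanBound (suc zero)    = 1ℚ
meanBound (suc (suc ℓ)) = meanBound ℓ + ℕ→ℚ 5

module _ {n m : ℕ} (f : SetFn n) (f-mod : OneModular f) (PS : Fin m → Subset n)
         (mean-single : Mean≤ (allFin m) (λ j → deficit+surplus f (PS j) (∁ (PS j))) 1ℚ) where

  mean-tupleLoad-1 : Mean≤ (allTuples 1 m) (tupleLoad f PS) (meanBound 1)
  mean-tupleLoad-1 = Mean≤-allTuples-1 {m = m}
    (subst (_≤ ℕ→ℚ (length (allFin m)) * 1ℚ) (sym (∑-cong (tupleLoad-[_] f PS) (allFin m)))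
           mean-single)

  mean-tupleLoad-2 : Mean≤ (allTuples 2 m) (tupleLoad f PS) (meanBound 2)
  mean-tupleLoad-2 =
    mean-split 1 1 {g = tupleLoad f PS} (tupleLoad-pair f PS f-mod) mean-tupleLoad-1 mean-tupleLoad-1

  mean-tupleLoad : ∀ ℓ → 1 ℕ.≤ ℓ → Mean≤ (allTuples ℓ m) (tupleLoad f PS) (meanBound ℓ)
  mean-tupleLoad (suc zero)          _ = mean-tupleLoad-1
  mean-tupleLoad (suc (suc zero))    _ = mean-tupleLoad-2
  mean-tupleLoad (suc (suc (suc ℓ))) _ =
    subst (Mean≤ (allTuples (3 ℕ.+ ℓ) m) (tupleLoad f PS)) (add-pair (meanBound (suc ℓ)))
      (mean-split 2 (suc ℓ) {g = tupleLoad f PS} (tupleLoad-split f PS f-mod 2)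
                  mean-tupleLoad-2 (mean-tupleLoad (suc ℓ) (s≤s z≤n)))
    where
    add-pair : ∀ B → 1ℚ * (ℕ→ℚ 3 + B) + ℕ→ℚ 2 ≡ B + ℕ→ℚ 5
    add-pair = solve-∀ ℚ-ring

x/2+y+5≡[x+2*5]/2+y : ∀ x y → ((+ x) / 2 + y) + ℕ→ℚ 5 ≡ (+ (x ℕ.+ 2 ℕ.* 5)) / 2 + y
x/2+y+5≡[x+2*5]/2+y x y =
  trans (swap ((+ x) / 2) y (ℕ→ℚ 5)) (cong (_+ y) (sym ([x+2y]/2≡x/2+y x 5)))
  where
  swap : ∀ a b c → (a + b) + c ≡ (a + c) + b
  swap = solve-∀ ℚ-ring

5ℓ+2*5≡5[2+ℓ] : ∀ ℓ → 5 ℕ.* ℓ ℕ.+ 2 ℕ.* 5 ≡ 5 ℕ.* suc (suc ℓ)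
5ℓ+2*5≡5[2+ℓ] = ℕSolver.solve-∀

meanBound-even : ∀ ℓ → ℓ % 2 ≡ 0 → meanBound ℓ ≡ (+ (5 ℕ.* ℓ)) / 2 - ℕ→ℚ 2
meanBound-even zero          _      = refl
meanBound-even (suc (suc ℓ)) ℓ-even = begin
  meanBound ℓ + ℕ→ℚ 5
    ≡⟨ cong (_+ ℕ→ℚ 5) (meanBound-even ℓ ℓ-even) ⟩
  ((+ (5 ℕ.* ℓ)) / 2 - ℕ→ℚ 2) + ℕ→ℚ 5
    ≡⟨ x/2+y+5≡[x+2*5]/2+y (5 ℕ.* ℓ) (- ℕ→ℚ 2) ⟩
  (+ (5 ℕ.* ℓ ℕ.+ 2 ℕ.* 5)) / 2 - ℕ→ℚ 2
    ≡⟨ cong (λ x → (+ x) / 2 - ℕ→ℚ 2) (5ℓ+2*5≡5[2+ℓ] ℓ) ⟩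
  (+ (5 ℕ.* suc (suc ℓ))) / 2 - ℕ→ℚ 2
    ∎
  where open ≡-Reasoning

meanBound-odd : ∀ ℓ → ℓ % 2 ≡ 1 → meanBound ℓ ≡ (+ (5 ℕ.* (ℓ ℕ.∸ 1))) / 2 + ℕ→ℚ 1
meanBound-odd (suc zero)          _     = refl
meanBound-odd (suc (suc (suc ℓ))) ℓ-odd = begin
  meanBound (suc ℓ) + ℕ→ℚ 5
    ≡⟨ cong (_+ ℕ→ℚ 5) (meanBound-odd (suc ℓ) ℓ-odd) ⟩
  ((+ (5 ℕ.* ℓ)) / 2 + ℕ→ℚ 1) + ℕ→ℚ 5
    ≡⟨ x/2+y+5≡[x+2*5]/2+y (5 ℕ.* ℓ) (ℕ→ℚ 1) ⟩
  (+ (5 ℕ.* ℓ ℕ.+ 2 ℕ.* 5)) / 2 + ℕ→ℚ 1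
    ≡⟨ cong (λ x → (+ x) / 2 + ℕ→ℚ 1) (5ℓ+2*5≡5[2+ℓ] ℓ) ⟩
  (+ (5 ℕ.* suc (suc ℓ))) / 2 + ℕ→ℚ 1
    ∎
  where open ≡-Reasoning

lemma6 : (n : ℕ) → 2 ℕ.≤ n → (f : SetFn n) → OneModular f → ClosestLinearIsZero f →
         (k : ℕ) → 1 ℕ.≤ k → (PS : Fin (2 ℕ.* k) → Subset n) →
         (∀ i → degree PS i ≡ k) →
         avg (map (λ j → deficit f (PS j)) (allFin (2 ℕ.* k)))
           + avg (map (λ j → surplus f (complements PS j)) (allFin (2 ℕ.* k))) ≤ ℕ→ℚ 1 →
         (ℓ : ℕ) → 1 ℕ.≤ ℓ →
         (ℓ % 2 ≡ 0 → dℓ f PS ℓ + sℓ f (complements PS) ℓ ≤ (+ (5 ℕ.* ℓ)) / 2 - ℕ→ℚ 2) ×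
         (ℓ % 2 ≡ 1 → dℓ f PS ℓ + sℓ f (complements PS) ℓ ≤ (+ (5 ℕ.* (ℓ ℕ.∸ 1))) / 2 + ℕ→ℚ 1)
lemma6 n _ f f-mod _ (suc k) _ PS _ avg≤1 ℓ ℓ≥1 =
    (λ ℓ-even → ℚP.≤-trans mean≤ (ℚP.≤-reflexive (meanBound-even ℓ ℓ-even)))
  , (λ ℓ-odd  → ℚP.≤-trans mean≤ (ℚP.≤-reflexive (meanBound-odd ℓ ℓ-odd)))
  where
  m : ℕ
  m = 2 ℕ.* suc k
  mean-single : Mean≤ (allFin m) (λ j → deficit+surplus f (PS j) (∁ (PS j))) 1ℚ
  mean-single = avg⇒Mean≤ (allFin m) (λ j → deficit+surplus f (PS j) (∁ (PS j)))
    (subst (_≤ 1ℚ) (avg-map-+ (allFin m) (deficit f ∘ PS) (surplus f ∘ complements PS)) avg≤1)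
  mean≤ : dℓ f PS ℓ + sℓ f (complements PS) ℓ ≤ meanBound ℓ
  mean≤ = subst (_≤ meanBound ℓ)
    (sym (avg-map-+ (allTuples ℓ m) (deficit f ∘ ⋂tuple PS) (surplus f ∘ ⋂tuple (complements PS))))
    (Mean≤⇒avg (allTuples ℓ m) (tupleLoad f PS) (allTuples-nonempty ℓ)
      (mean-tupleLoad f f-mod PS mean-single ℓ ℓ≥1))
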